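{- Let $q(\vec x)$ be an $n$-ary query over a schema $\mathcal{S}$ consisting of relational atoms and possibly similarity atoms (no inequality atoms), $D$ an $\mathcal{S}$-database, $\vec c$ an $n$-tuple of constants, $E,E'$ equivalence relations on $\mathsf{Obj}(D)$ and $V,V'$ equivalence relations on $\mathsf{Cells}(D)$. If $\vec c\in q(D_{E,V})$ and $E\cup V\subseteq E'\cup V'$, then $\vec c\in q(D_{E',V'})$.
   Context: Constants come from three pairwise disjoint infinite sets: objects $\mathsf{O}$, values $\mathsf{V}$, and tuple identifiers (tids) $\mathsf{TID}$. A schema $\mathcal{S}$ is a finite set of relation symbols $R$, each with an arity $k$ and a type vector in $\{\mathsf{O},\mathsf{V}\}^k$. An $\mathcal{S}$-database $D$ is a finite set of facts $R(t,c_1,\dots,c_k)$ with $R/k\in\mathcal{S}$, $t\in\mathsf{TID}$, $c_i\in\mathbf{type}(R,i)$, each tid occurring in at most one fact; $t[i]$ is the constant at position $i$ of the fact with tid $t$. $\mathsf{Obj}(D)$ is the set of objects occurring in $D$, $\mathsf{Dom}(D)$ the set of constants occurring in $D$, and $\mathsf{Cells}(D)=\{\langle t,i\rangle\mid R(t,c_1,\dots,c_k)\in D,\ \mathbf{type}(R,i)=\mathsf{V}\}$. A query $q(\vec x)=\exists\vec y.\varphi(\vec x,\vec y)$ has $\varphi$ a conjunction of relational atoms $R(u_0,u_1,\dots,u_k)$ ($u_0$ in the tid position, terms constants or variables), possibly also atoms $u\approx u'$ of binary similarity predicates with a fixed interpretation over constants. Induced database: for an equivalence relation $E$ on $\mathsf{Obj}(D)$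 and $V$ on $\mathsf{Cells}(D)$, $D_{E,V}$ is obtained from $D$ by replacing each tid $t$ by $\{t\}$, each occurrence of an object $o$ by $\{o'\mid(o,o')\in E\}$, and the value in each cell $\langle t,i\rangle$ by $\{t'[i']\mid(\langle t,i\rangle,\langle t',i'\rangle)\in V\}$. A Boolean query $q$ is satisfied in $D_{E,V}$ if there are $h:\mathrm{vars}(q)\cup\mathrm{cons}(q)\to 2^{\mathsf{Dom}(D)}\setminus\{\emptyset\}$ and, for each $k$-ary relational atom $\pi$ of $q$, $g_\pi:\{0,\dots,k\}\to 2^{\mathsf{Dom}(D)}$ such that: (1) $h(a)=\{a\}$ for constants $a$, and for each variable $z$, $h(z)$ is the intersection of all $g_\pi(i)$ with $z$ the $i$-th argument of $\pi$; (2) for each relational atom $\pi=R(u_0,\dots,u_k)$, $R(g_\pi(0),\dots,g_\pi(k))\in D_{E,V}$, and $u_i\in g_\pi(i)$ whenever $u_i$ is a constant; (3) for each inequality $z\neq z'$ (if any), $h(z)\cap h(z')=\emptyset$; (4) for each $u\approx u'$, some $c\in h(u)$, $c'\in h(u')$ satisfy $c\approx c'$. $q(D_{E,V})$ is the set of tuples $\vec c$ with $D_{E,V}\models q[\vec c]$, where $q[\vec c]$ replaces the free variables by $\vec c$. -}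

module Defs where

open import Data.Nat using (ℕ; suc)
open import Data.Fin using (Fin; zero; suc; toℕ)
open import Data.Product using (Σ; ∃; _×_; _,_)
open import Data.Sum using (_⊎_; inj₁; inj₂)
open import Data.Empty using (⊥)
open import Data.Unit using (⊤)
open import Data.List using (List)
open import Data.List.Membership.Propositional using (_∈_)
open import Relation.Binary.PropositionalEquality using (_≡_)

-- Constants: three pairwise disjoint infinite sets O, V, TID
-- (each a copy of ℕ, distinguished by the constructor).

data Const : Set where
  obj  : ℕ → Const
  val  : ℕ → Const
  tidc : ℕ → Const

data AttrType : Set where
  TO TV : AttrType

HasType : AttrType → Const → Set
HasType TO (obj _) = ⊤
HasType TO _       = ⊥
HasType TV (val _) = ⊤
HasType TV _       = ⊥

-- Sets of constants (subsets of Dom(D)) are predicates on constants;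
-- equality of sets is extensional.

Pred : Set₁
Pred = Const → Set

single : Const → Pred
single a c = c ≡ a

_≐_ : Pred → Pred → Set
P ≐ Q = ∀ c → (P c → Q c) × (Q c → P c)

record Schema : Set₁ where
  field
    Rel   : Set
    arity : Rel → ℕ
    type  : (R : Rel) → Fin (arity R) → AttrType
open Schema public

-- Databases.  A fact R(t, c₁,…,c_k): the tid t ∈ TID is stored as the
-- number t (the constant being 'tidc t'); argument j : Fin k is position
-- 1 + toℕ j of the paper.

record Fact (S : Schema) : Set where
  constructor fact
  field
    rel  : Rel S
    tid  : ℕ
    args : Fin (arity S rel) → Const
open Fact public

record Database (S : Schema) : Set where
  field
    facts     : List (Fact S)
    welltyped : ∀ f → f ∈ facts → ∀ j → HasType (type S (rel f) j) (args f j)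
    tidUnique : ∀ f f' → f ∈ facts → f' ∈ facts → tid f ≡ tid f' → f ≡ f'
open Database public

module _ {S : Schema} (D : Database S) where

  Obj : ℕ → Set
  Obj o = Σ (Fact S) λ f → f ∈ facts D × Σ (Fin (arity S (rel f))) λ j → args f j ≡ obj o

  Dom : Pred
  Dom c = Σ (Fact S) λ f → f ∈ facts D ×
            (c ≡ tidc (tid f) ⊎ Σ (Fin (arity S (rel f))) λ j → args f j ≡ c)

  -- cells ⟨t,i⟩ (t a tid number, i a 1-based position)
  Cell : Set
  Cell = ℕ × ℕ

  IsCell : Cell → Set
  IsCell (t , i) = Σ (Fact S) λ f → f ∈ facts D × tid f ≡ t ×
                     Σ (Fin (arity S (rel f))) λ j → suc (toℕ j) ≡ i × type S (rel f) j ≡ TV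

  CellVal : Cell → Const → Set
  CellVal (t , i) c = Σ (Fact S) λ f → f ∈ facts D × tid f ≡ t ×
                        Σ (Fin (arity S (rel f))) λ j → suc (toℕ j) ≡ i × args f j ≡ c

record IsEquivOn {A : Set} (P : A → Set) (R : A → A → Set) : Set where
  field
    domain : ∀ x y → R x y → P x × P y
    refl   : ∀ x → P x → R x x
    sym    : ∀ x y → R x y → R y x
    trans  : ∀ x y z → R x y → R y z → R x z

-- E ∪ V as one relation on Obj ⊎ Cells (objects and cells are disjoint)
UnionRel : (ℕ → ℕ → Set) → (ℕ × ℕ → ℕ × ℕ → Set) → (ℕ ⊎ (ℕ × ℕ)) → (ℕ ⊎ (ℕ × ℕ)) → Set
UnionRel E V (inj₁ o) (inj₁ o') = E o o'
UnionRel E V (inj₂ x) (inj₂ y)  = V x y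
UnionRel E V _        _         = ⊥

module _ {S : Schema} (D : Database S) (E : ℕ → ℕ → Set) (V : Cell D → Cell D → Set) where

  -- the set replacing the constant a stored in cell/position x
  entryC : Const → Cell D → Pred
  entryC (obj o)  _ c = Σ ℕ λ o' → E o o' × c ≡ obj o'
  entryC (val _)  x c = Σ (Cell D) λ y → V x y × CellVal D y c
  entryC (tidc t) _ c = c ≡ tidc t   -- impossible for well-typed facts

  entry : (f : Fact S) → Fin (arity S (rel f)) → Pred
  entry f j = entryC (args f j) (tid f , suc (toℕ j))

  data InducedOf (f : Fact S) : (R : Rel S) → (Fin (suc (arity S R)) → Pred) → Set₁ where
    induced : {G : Fin (suc (arity S (rel f))) → Pred} →
              G zero ≐ single (tidc (tid f)) →
              (∀ j → G (suc j) ≐ entry f j) →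
              InducedOf f (rel f) G

  InInduced : (R : Rel S) → (Fin (suc (arity S R)) → Pred) → Set₁
  InInduced R G = Σ (Fact S) λ f → f ∈ facts D × InducedOf f R G

record SimSig : Set₁ where
  field
    Sym    : Set
    interp : Sym → Const → Const → Set
open SimSig public

data Term (n m : ℕ) : Set where
  fv  : Fin n → Term n m
  bv  : Fin m → Term n m
  cst : Const → Term n m

data BTerm (m : ℕ) : Set where
  bv  : Fin m → BTerm m
  cst : Const → BTerm m

record Query (S : Schema) (Σs : SimSig) (n : ℕ) : Set where
  field
    m        : ℕ
    nrel     : ℕ
    atomRel  : Fin nrel → Rel S
    atomArg  : (a : Fin nrel) → Fin (suc (arity S (atomRel a))) → Term n m
    nsim     : ℕ
    simSym   : Fin nsim → Sym Σs
    simLeft  : Fin nsim → Term n m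
    simRight : Fin nsim → Term n m
open Query public

inst : ∀ {n m} → (Fin n → Const) → Term n m → BTerm m
inst c (fv i)  = cst (c i)
inst c (bv z)  = bv z
inst c (cst a) = cst a

hT : ∀ {m} → (Fin m → Pred) → BTerm m → Pred
hT h (bv z)  = h z
hT h (cst a) = single a

Sat : {S : Schema} {Σs : SimSig} {n : ℕ} →
      (D : Database S) (E : ℕ → ℕ → Set) (V : Cell D → Cell D → Set) →
      Query S Σs n → (Fin n → Const) → Set₁
Sat {S} {Σs} D E V q c =
  Σ (Fin (m q) → Pred) λ h →
  Σ ((a : Fin (nrel q)) → Fin (suc (arity S (atomRel q a))) → Pred) λ g →
    (∀ z → Σ Const (h z)) ×
    -- (1) h(z) is the intersection (within Dom(D)) of the g_π(i) with z at position i of π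
    (∀ z → h z ≐ (λ c' → Dom D c' × (∀ a i → inst c (atomArg q a i) ≡ bv z → g a i c'))) ×
    -- constants of q[c] are in Dom(D) (h(a) = {a} ∈ 2^Dom(D))
    (∀ a i k → inst c (atomArg q a i) ≡ cst k → Dom D k) ×
    (∀ s k → inst c (simLeft q s) ≡ cst k → Dom D k) ×
    (∀ s k → inst c (simRight q s) ≡ cst k → Dom D k) ×
    -- (2) R(g_π(0),…,g_π(k)) ∈ D_{E,V} and constants u_i ∈ g_π(i)
    (∀ a → InInduced D E V (atomRel q a) (g a)) ×
    (∀ a i k → inst c (atomArg q a i) ≡ cst k → g a i k) ×
    (∀ s → Σ Const λ d → Σ Const λ d' →
             hT h (inst c (simLeft q s)) d × hT h (inst c (simRight q s)) d' ×
             interp Σs (simSym q s) d d')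

InAnswer : {S : Schema} {Σs : SimSig} {n : ℕ} →
           (Fin n → Const) → Query S Σs n →
           (D : Database S) (E : ℕ → ℕ → Set) (V : Cell D → Cell D → Set) → Set₁
InAnswer c q D E V = Sat D E V q c

-- Every ingredient of a match of q in D_{E,V} only grows when E and V grow: each entry
-- {o' | E o o'} or {t'[i'] | V ⟨t,i⟩ ⟨t',i'⟩} of an induced fact is contained in the
-- corresponding entry for E', V'.  So each g_π can be enlarged to the matching induced
-- fact of D_{E',V'}, h is recomputed as the intersection of the enlarged g_π, and the
-- constants and similarity witnesses carry over unchanged.  Since q has no inequality
-- atoms, nothing forces the sets to stay small.
module Submission where

open import Defs
open import Data.Nat using (ℕ; suc)
open import Data.Fin using (Fin; zero; suc)
open import Data.Sum using (inj₁; inj₂)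
open import Data.Product using (_×_; Σ; _,_; proj₁; proj₂; map₂)
open import Function using (id)
open import Relation.Binary.Core using (_⇒_)
open import Relation.Binary.PropositionalEquality using (_≡_)
open import Relation.Unary using (_⊆_)

module _ {E E' : ℕ → ℕ → Set} {V V' : ℕ × ℕ → ℕ × ℕ → Set} where

  UnionRel-⊆ˡ : (∀ x y → UnionRel E V x y → UnionRel E' V' x y) → E ⇒ E'
  UnionRel-⊆ˡ E∪V⊆E'∪V' {o} {o'} = E∪V⊆E'∪V' (inj₁ o) (inj₁ o')

  UnionRel-⊆ʳ : (∀ x y → UnionRel E V x y → UnionRel E' V' x y) → V ⇒ V'
  UnionRel-⊆ʳ E∪V⊆E'∪V' {x} {y} = E∪V⊆E'∪V' (inj₂ x) (inj₂ y)

module _ {S : Schema} (D : Database S) {E E' : ℕ → ℕ → Set} {V V' : Cell D → Cell D → Set}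
         (E⇒E' : E ⇒ E') (V⇒V' : V ⇒ V') where

  entryC-mono : ∀ a x → entryC D E V a x ⊆ entryC D E' V' a x
  entryC-mono (obj o)  x (o' , Eoo' , eq) = o' , E⇒E' Eoo' , eq
  entryC-mono (val _)  x (y , Vxy , cv)   = y , V⇒V' Vxy , cv
  entryC-mono (tidc t) x p                = p

  InducedOf-mono : ∀ {f R G} → InducedOf D E V f R G →
                   Σ (Fin (suc (arity S R)) → Pred) λ G' →
                     InducedOf D E' V' f R G' × (∀ i → G i ⊆ G' i)
  InducedOf-mono {f} {G = G} (induced G0≐tid G≐entry) =
    G' , induced (λ _ → id , id) (λ _ _ → id , id) , G⊆G'
    where
    G' : Fin (suc (arity S (rel f))) → Pred
    G' zero    = single (tidc (tid f))
    G' (suc j) = entry D E' V' f j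
    G⊆G' : ∀ i → G i ⊆ G' i
    G⊆G' zero    p = proj₁ (G0≐tid _) p
    G⊆G' (suc j) p = entryC-mono (args f j) _ (proj₁ (G≐entry j _) p)

  InInduced-mono : ∀ {R G} → InInduced D E V R G →
                   Σ (Fin (suc (arity S R)) → Pred) λ G' →
                     InInduced D E' V' R G' × (∀ i → G i ⊆ G' i)
  InInduced-mono (f , f∈D , ind) with InducedOf-mono ind
  ... | G' , ind' , G⊆G' = G' , (f , f∈D , ind') , G⊆G'

hT-mono : ∀ {m} {h h' : Fin m → Pred} → (∀ z → h z ⊆ h' z) → ∀ t → hT h t ⊆ hT h' t
hT-mono h⊆h' (bv z)  = h⊆h' z
hT-mono h⊆h' (cst a) = id

Sat-mono : {S : Schema} {Σs : SimSig} {n : ℕ} (D : Database S)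
           {E E' : ℕ → ℕ → Set} {V V' : Cell D → Cell D → Set} →
           E ⇒ E' → V ⇒ V' → (q : Query S Σs n) (c : Fin n → Const) →
           Sat D E V q c → Sat D E' V' q c
Sat-mono {S} {Σs} D {E' = E'} {V' = V'} E⇒E' V⇒V' q c
         (h , g , h-nonempty , h≐⋂g , atom-csts∈Dom , simˡ-csts∈Dom , simʳ-csts∈Dom , g-induced , g∋cst , sims) =
  h' , g' , h'-nonempty , (λ _ _ → id , id) , atom-csts∈Dom , simˡ-csts∈Dom , simʳ-csts∈Dom , g'-induced , g'∋cst , sims'
  where
  enlarged : ∀ a → Σ (Fin (suc (arity S (atomRel q a))) → Pred) λ G' →
               InInduced D E' V' (atomRel q a) G' × (∀ i → g a i ⊆ G' i)
  enlarged a = InInduced-mono D E⇒E' V⇒V' (g-induced a)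

  g' : (a : Fin (nrel q)) → Fin (suc (arity S (atomRel q a))) → Pred
  g' a = proj₁ (enlarged a)

  g⊆g' : ∀ a i → g a i ⊆ g' a i
  g⊆g' a = proj₂ (proj₂ (enlarged a))

  g'-induced : ∀ a → InInduced D E' V' (atomRel q a) (g' a)
  g'-induced a = proj₁ (proj₂ (enlarged a))

  g'∋cst : ∀ a i k → inst c (atomArg q a i) ≡ cst k → g' a i k
  g'∋cst a i k eq = g⊆g' a i (g∋cst a i k eq)

  h' : Fin (m q) → Pred
  h' z c' = Dom D c' × (∀ a i → inst c (atomArg q a i) ≡ bv z → g' a i c')

  h⊆h' : ∀ z → h z ⊆ h' z
  h⊆h' z p with proj₁ (h≐⋂g z _) p
  ... | c'∈D , c'∈g = c'∈D , λ a i eq → g⊆g' a i (c'∈g a i eq)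

  h'-nonempty : ∀ z → Σ Const (h' z)
  h'-nonempty z = map₂ (h⊆h' z) (h-nonempty z)

  sims' : ∀ s → Σ Const λ d → Σ Const λ d' →
            hT h' (inst c (simLeft q s)) d × hT h' (inst c (simRight q s)) d' ×
            interp Σs (simSym q s) d d'
  sims' s with sims s
  ... | d , d' , d∈l , d'∈r , d≈d' =
    d , d' , hT-mono h⊆h' (inst c (simLeft q s)) d∈l , hT-mono h⊆h' (inst c (simRight q s)) d'∈r , d≈d'

lemma2 : {S : Schema} {Σs : SimSig} {n : ℕ}
    (q : Query S Σs n) (D : Database S) (c : Fin n → Const)
    (E E' : ℕ → ℕ → Set) (V V' : ℕ × ℕ → ℕ × ℕ → Set) →
    IsEquivOn (Obj D) E → IsEquivOn (Obj D) E' →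
    IsEquivOn (IsCell D) V → IsEquivOn (IsCell D) V' →
    InAnswer c q D E V →
    (∀ x y → UnionRel E V x y → UnionRel E' V' x y) →
    InAnswer c q D E' V'
lemma2 q D c E E' V V' _ _ _ _ c∈q[D_EV] E∪V⊆E'∪V' =
  Sat-mono D (UnionRel-⊆ˡ E∪V⊆E'∪V') (UnionRel-⊆ʳ E∪V⊆E'∪V') q c c∈q[D_EV]
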